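{- Let $p$ be a prime and let $I=[a,b]$ be an interval in $\mathbb F_p$ with $4\le|I|\le p-3$. Then for any $x\in I\setminus\{a,b\}$, the set $I\setminus\{x\}$ is not an arithmetic progression in $\mathbb F_p$.
   Context: For $a,b\in\mathbb F_p$, $[a,b]=\{a,a+1,\dots,b\}\subseteq\mathbb F_p$ (cyclic interval). A set $X\subseteq\mathbb F_p$ is an arithmetic progression if its elements can be listed as $y,y+d,\dots,y+(|X|-1)d$ for some $y\in\mathbb F_p$ and $d\in\mathbb F_p\setminus\{0\}$. -}

module Defs where

open import Data.Nat using (ℕ; _+_; _*_; _∸_; _≤_; _<_; NonZero)
open import Data.Nat.DivMod using (_mod_)
open import Data.Nat.Properties using (_≤?_)
open import Data.Fin using (Fin; toℕ)
open import Data.Fin.Subset using (Subset; _∈_; ∣_∣)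
open import Data.Vec using (tabulate)
open import Data.Product using (Σ; _×_)
open import Function.Bundles using (_⇔_)
open import Relation.Binary.PropositionalEquality using (_≡_; _≢_)
open import Relation.Nullary using (does)

-- F_p is modelled as Fin p with arithmetic mod p.
module _ {p : ℕ} .{{_ : NonZero p}} where

  _+ₚ_ : Fin p → Fin p → Fin p
  x +ₚ y = (toℕ x + toℕ y) mod p

  _-ₚ_ : Fin p → Fin p → Fin p
  x -ₚ y = (toℕ x + (p ∸ toℕ y)) mod p

  _·ₚ_ : ℕ → Fin p → Fin p
  k ·ₚ d = (k * toℕ d) mod p

  zeroₚ : Fin p
  zeroₚ = 0 mod p

  -- the cyclic interval [a,b] = {a, a+1, ..., b}: z ∈ [a,b] iff z - a ∈ {0,...,b - a}
  -- (where b - a is taken as its representative in {0,...,p-1})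
  interval : Fin p → Fin p → Subset p
  interval a b = tabulate (λ z → does (toℕ (z -ₚ a) ≤? toℕ (b -ₚ a)))

  IsAP : Subset p → Set
  IsAP X = Σ (Fin p) λ y → Σ (Fin p) λ d → (d ≢ zeroₚ) ×
             ((z : Fin p) → (z ∈ X) ⇔ Σ ℕ (λ k → (k < ∣ X ∣) × (z ≡ y +ₚ (k ·ₚ d))))

{-# OPTIONS --safe #-}
-- Measure positions from a: the interval I becomes {0, …, L} with L = |I| - 1, and I ∖ {x}
-- becomes {0, …, L} ∖ {j} with 0 < j < L. If I ∖ {x} were an arithmetic progression with
-- difference d, its last term would be the only element z with z + d outside it. But adding
-- t = d (mod p) to positions always moves at least two elements of {0, …, L} ∖ {j} out of it,
-- into the gap {L + 1, …, p - 1} (which has at least three elements) or onto the hole j.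
module Submission where

open import Data.Bool using (Bool; true; false; if_then_else_)
open import Data.Fin using (Fin; toℕ) renaming (zero to fzero; suc to fsuc)
open import Data.Fin.Permutation using (Permutation; permutation; _⟨$⟩ʳ_)
open import Data.Fin.Properties using (toℕ-fromℕ<; toℕ-injective; toℕ<n)
open import Data.Fin.Subset using (Subset; _∈_; _∉_; ∣_∣; _∩_; ∁; ⁅_⁆)
open import Data.Fin.Subset.Properties using (x∈p∩q⁺; x∈p∩q⁻; x∉p⇒x∈∁p; x∈∁p⇒x∉p; x∈⁅y⁆⇔x≡y)
open import Data.Nat
  using (ℕ; zero; suc; pred; _+_; _*_; _∸_; _≤_; _<_; NonZero; >-nonZero⁻¹; z≤n; s≤s; s≤s⁻¹; _≤?_; _<?_)
open import Data.Nat.Divisibility using (∣-refl)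
open import Data.Nat.DivMod
open import Data.Nat.Primality using (Prime)
open import Data.Nat.Properties
open import Algebra.Properties.CommutativeSemigroup +-commutativeSemigroup using (x∙yz≈y∙xz; xy∙z≈xz∙y)
open import Algebra.Properties.CommutativeMonoid.Sum +-0-commutativeMonoid
  using (sum-syntax; sum-permute)
open import Data.Product using (Σ; ∃; ∃₂; _×_; _,_)
open import Data.Vec using (tabulate)
open import Data.Vec.Properties using (tabulate-cong; lookup∘tabulate; lookup⇒[]=; []=⇒lookup)
open import Defs
open import Function using (_∘_)
open import Function.Bundles using (_⇔_; mk⇔; Equivalence)
open import Relation.Binary.PropositionalEquality
open import Relation.Nullary using (¬_; does; proof; yes; no)
open import Relation.Nullary.Decidable using (dec-true)
open import Relation.Nullary.Reflects using (Reflects; invert)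
open import Relation.Unary using (Pred; Decidable)

[m%d+n]%d≡[m+n]%d : ∀ m n d .{{_ : NonZero d}} → (m % d + n) % d ≡ (m + n) % d
[m%d+n]%d≡[m+n]%d m n d = begin
  (m % d + n) % d          ≡⟨ %-distribˡ-+ (m % d) n d ⟩
  (m % d % d + n % d) % d  ≡⟨ cong (λ r → (r + n % d) % d) (m%n%n≡m%n m d) ⟩
  (m % d + n % d) % d      ≡⟨ %-distribˡ-+ m n d ⟨
  (m + n) % d              ∎
  where open ≡-Reasoning

[m+n%d]%d≡[m+n]%d : ∀ m n d .{{_ : NonZero d}} → (m + n % d) % d ≡ (m + n) % d
[m+n%d]%d≡[m+n]%d m n d = begin
  (m + n % d) % d  ≡⟨ cong (_% d) (+-comm m (n % d)) ⟩
  (n % d + m) % d  ≡⟨ [m%d+n]%d≡[m+n]%d n m d ⟩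
  (n + m) % d      ≡⟨ cong (_% d) (+-comm n m) ⟩
  (m + n) % d      ∎
  where open ≡-Reasoning

module _ {p : ℕ} .{{_ : NonZero p}} where
  open ≡-Reasoning

  -- Definitionally y +ₚ z = y ⊕ toℕ z and z -ₚ a = z ⊕ (p ∸ toℕ a), so the ⊕ lemmas apply to both.
  infixl 6 _⊕_
  _⊕_ : Fin p → ℕ → Fin p
  a ⊕ i = (toℕ a + i) mod p

  offset : Fin p → Fin p → ℕ
  offset a z = toℕ (z -ₚ a)

  toℕ-mod : ∀ m → toℕ (m mod p) ≡ m % p
  toℕ-mod m = toℕ-fromℕ< (m%n<n m p)

  mod-cong : ∀ {m n} → m % p ≡ n % p → m mod p ≡ n mod p
  mod-cong {m} {n} eq = toℕ-injective (trans (toℕ-mod m) (trans eq (sym (toℕ-mod n))))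

  ⊕-toℕ-mod : ∀ a m → a ⊕ toℕ (m mod p) ≡ a ⊕ m
  ⊕-toℕ-mod a m = mod-cong (begin
    (toℕ a + toℕ (m mod p)) % p  ≡⟨ cong (λ r → (toℕ a + r) % p) (toℕ-mod m) ⟩
    (toℕ a + m % p) % p          ≡⟨ [m+n%d]%d≡[m+n]%d (toℕ a) m p ⟩
    (toℕ a + m) % p              ∎)

  ⊕-+ : ∀ a i k → a ⊕ i ⊕ k ≡ a ⊕ (i + k)
  ⊕-+ a i k = mod-cong (begin
    (toℕ (a ⊕ i) + k) % p    ≡⟨ cong (λ r → (r + k) % p) (toℕ-mod (toℕ a + i)) ⟩
    ((toℕ a + i) % p + k) % p ≡⟨ [m%d+n]%d≡[m+n]%d (toℕ a + i) k p ⟩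
    (toℕ a + i + k) % p       ≡⟨ cong (_% p) (+-assoc (toℕ a) i k) ⟩
    (toℕ a + (i + k)) % p     ∎)

  toℕ-⊕-+-∸ : ∀ a i → toℕ (a ⊕ (i + (p ∸ toℕ a))) ≡ i % p
  toℕ-⊕-+-∸ a i = begin
    toℕ (a ⊕ (i + (p ∸ toℕ a)))      ≡⟨ toℕ-mod _ ⟩
    (toℕ a + (i + (p ∸ toℕ a))) % p  ≡⟨ cong (_% p) (x∙yz≈y∙xz (toℕ a) i _) ⟩
    (i + (toℕ a + (p ∸ toℕ a))) % p  ≡⟨ cong (λ r → (i + r) % p) (m+[n∸m]≡n (<⇒≤ (toℕ<n a))) ⟩
    (i + p) % p                      ≡⟨ [m+n]%n≡m%n i p ⟩
    i % p                            ∎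

  offset-⊕ : ∀ a i → offset a (a ⊕ i) ≡ i % p
  offset-⊕ a i = trans (cong toℕ (⊕-+ a i (p ∸ toℕ a))) (toℕ-⊕-+-∸ a i)

  ⊕-offset : ∀ a z → a ⊕ offset a z ≡ z
  ⊕-offset a z = toℕ-injective (begin
    toℕ (a ⊕ offset a z)                 ≡⟨ cong toℕ (⊕-toℕ-mod a _) ⟩
    toℕ (a ⊕ (toℕ z + (p ∸ toℕ a)))      ≡⟨ toℕ-⊕-+-∸ a (toℕ z) ⟩
    toℕ z % p                            ≡⟨ m<n⇒m%n≡m (toℕ<n z) ⟩
    toℕ z                                ∎)

  offset-injective : ∀ a {z w} → offset a z ≡ offset a w → z ≡ w
  offset-injective a {z} {w} eq = begin
    z                ≡⟨ ⊕-offset a z ⟨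
    a ⊕ offset a z   ≡⟨ cong (a ⊕_) eq ⟩
    a ⊕ offset a w   ≡⟨ ⊕-offset a w ⟩
    w                ∎

  offset-self : ∀ a → offset a a ≡ 0
  offset-self a = begin
    offset a a                   ≡⟨ toℕ-mod _ ⟩
    (toℕ a + (p ∸ toℕ a)) % p    ≡⟨ cong (_% p) (m+[n∸m]≡n (<⇒≤ (toℕ<n a))) ⟩
    p % p                        ≡⟨ n%n≡0 p ⟩
    0                            ∎

  offset-positive : ∀ a {z} → z ≢ a → 0 < offset a z
  offset-positive a z≢a = n≢0⇒n>0 λ offset≡0 →
    z≢a (offset-injective a (trans offset≡0 (sym (offset-self a))))

  toℕ-positive : ∀ {d : Fin p} → d ≢ zeroₚ → 0 < toℕ d
  toℕ-positive d≢0 = n≢0⇒n>0 λ toℕ≡0 →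
    d≢0 (toℕ-injective (trans toℕ≡0 (sym (trans (toℕ-mod 0) (m<n⇒m%n≡m (>-nonZero⁻¹ p))))))

  ·ₚ-suc : ∀ y d k → y +ₚ (suc k ·ₚ d) ≡ (y +ₚ (k ·ₚ d)) +ₚ d
  ·ₚ-suc y d k = begin
    y ⊕ toℕ (suc k ·ₚ d)           ≡⟨ ⊕-toℕ-mod y _ ⟩
    y ⊕ (toℕ d + k * toℕ d)        ≡⟨ cong (y ⊕_) (+-comm (toℕ d) (k * toℕ d)) ⟩
    y ⊕ (k * toℕ d + toℕ d)        ≡⟨ ⊕-+ y _ _ ⟨
    y ⊕ (k * toℕ d) ⊕ toℕ d        ≡⟨ cong (_⊕ toℕ d) (⊕-toℕ-mod y _) ⟨
    y ⊕ toℕ (k ·ₚ d) ⊕ toℕ d       ∎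

  translation : Fin p → Permutation p p
  translation a = permutation (_-ₚ a) (λ w → a ⊕ toℕ w)
    (λ w → toℕ-injective (trans (offset-⊕ a (toℕ w)) (m<n⇒m%n≡m (toℕ<n w))))
    (⊕-offset a)

∈-tabulate⇔ : ∀ {n ℓ} {P : Pred (Fin n) ℓ} (P? : Decidable P) {z} → z ∈ tabulate (does ∘ P?) ⇔ P z
∈-tabulate⇔ P? {z} = mk⇔
  (λ z∈ → invert (subst (Reflects _) (trans (sym (lookup∘tabulate _ z)) ([]=⇒lookup z∈)) (proof (P? z))))
  (λ Pz → lookup⇒[]= z _ (trans (lookup∘tabulate _ z) (dec-true (P? z) Pz)))

∣tabulate∣≡∑ : ∀ {n} (f : Fin n → Bool) → ∣ tabulate f ∣ ≡ ∑[ z < n ] (if f z then 1 else 0)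
∣tabulate∣≡∑ {zero} f = refl
∣tabulate∣≡∑ {suc n} f with f fzero
... | true  = cong suc (∣tabulate∣≡∑ (f ∘ fsuc))
... | false = ∣tabulate∣≡∑ (f ∘ fsuc)

∣tabulate∣-permute : ∀ {n} (f : Fin n → Bool) (π : Permutation n n) →
                     ∣ tabulate (f ∘ (π ⟨$⟩ʳ_)) ∣ ≡ ∣ tabulate f ∣
∣tabulate∣-permute {n} f π = begin
  ∣ tabulate (f ∘ (π ⟨$⟩ʳ_)) ∣                  ≡⟨ ∣tabulate∣≡∑ (f ∘ (π ⟨$⟩ʳ_)) ⟩
  ∑[ z < n ] (if f (π ⟨$⟩ʳ z) then 1 else 0)   ≡⟨ sum-permute (λ w → if f w then 1 else 0) π ⟨
  ∑[ w < n ] (if f w then 1 else 0)             ≡⟨ ∣tabulate∣≡∑ f ⟨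
  ∣ tabulate f ∣                                ∎
  where open ≡-Reasoning

∣tabulate-≤∣ : ∀ {n} L → L < n → ∣ tabulate {n} (λ w → does (toℕ w ≤? L)) ∣ ≡ suc L
∣tabulate-≤∣ {suc n} zero    _         = cong suc (∣tabulate-≤0∣ n)
  where
  ∣tabulate-≤0∣ : ∀ n → ∣ tabulate {n} (λ w → does (suc (toℕ w) ≤? 0)) ∣ ≡ 0
  ∣tabulate-≤0∣ zero    = refl
  ∣tabulate-≤0∣ (suc n) = ∣tabulate-≤0∣ n
∣tabulate-≤∣ {suc n} (suc L) (s≤s L<n) =
  cong suc (trans (cong ∣_∣ (tabulate-cong {n = n} (does-s≤s ∘ toℕ))) (∣tabulate-≤∣ L L<n))
  where
  does-s≤s : ∀ i → does (suc i ≤? suc L) ≡ does (i ≤? L)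
  does-s≤s zero    = refl
  does-s≤s (suc i) = refl

Punctured : ℕ → ℕ → ℕ → Set
Punctured L j i = i ≤ L × i ≢ j

-- In positions measured from a, I ∖ {x} is Punctured L j (L = offset a b, j = offset a x),
-- and adding d sends position i to (i + toℕ d) % p.
IsExit : (p : ℕ) .{{_ : NonZero p}} (L j t i : ℕ) → Set
IsExit p L j t i = Punctured L j i × ¬ Punctured L j ((i + t) % p)

TwoExits : (p : ℕ) .{{_ : NonZero p}} (L j t : ℕ) → Set
TwoExits p L j t = ∃₂ λ i₁ i₂ → i₁ ≢ i₂ × IsExit p L j t i₁ × IsExit p L j t i₂

gap-exit : ∀ {p L j t i} .{{_ : NonZero p}} → Punctured L j i → L < i + t → i + t < p → IsExit p L j t i
gap-exit i∈ L<i+t i+t<p = i∈ , λ (i+t≤L , _) → <⇒≱ L<i+t (subst (_≤ _) (m<n⇒m%n≡m i+t<p) i+t≤L)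

hole-exit : ∀ {p L j t i} .{{_ : NonZero p}} → Punctured L j i → (i + t) % p ≡ j → IsExit p L j t i
hole-exit i∈ i+t≡j = i∈ , λ (_ , i+t≢j) → i+t≢j i+t≡j

two-of-three : ∀ {P : ℕ → Set} c j → (∀ k → k ≤ 2 → c + k ≢ j → P (c + k)) →
               ∃₂ λ i₁ i₂ → i₁ ≢ i₂ × P i₁ × P i₂
two-of-three {P} c j P[c+_] = pick
  where
  apart : ∀ {k l} → k ≢ l → c + k ≢ c + l
  apart k≢l = k≢l ∘ +-cancelˡ-≡ c _ _
  avoid : ∀ {k l} → c + k ≡ j → k ≢ l → c + l ≢ j
  avoid c+k≡j k≢l c+l≡j = apart k≢l (trans c+k≡j (sym c+l≡j))
  pick : ∃₂ λ i₁ i₂ → i₁ ≢ i₂ × P i₁ × P i₂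
  pick with c + 0 ≟ j | c + 1 ≟ j
  ... | yes c≡j | _         = c + 1 , c + 2 , apart (λ ()) ,
                              P[c+_] 1 (s≤s z≤n) (avoid c≡j (λ ())) , P[c+_] 2 ≤-refl (avoid c≡j (λ ()))
  ... | no c≢j  | yes c+1≡j = c + 0 , c + 2 , apart (λ ()) ,
                              P[c+_] 0 z≤n c≢j , P[c+_] 2 ≤-refl (avoid c+1≡j (λ ()))
  ... | no c≢j  | no c+1≢j  = c + 0 , c + 1 , apart (λ ()) ,
                              P[c+_] 0 z≤n c≢j , P[c+_] 1 (s≤s z≤n) c+1≢j

k+m≤m+n : ∀ m {k n} → k ≤ n → k + m ≤ m + n
k+m≤m+n m {k} {n} k≤n = subst (_≤ m + n) (+-comm m k) (+-monoʳ-≤ m k≤n)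

-- Either j - t lands on the hole, or t > j and L - 1 lands in the gap
-- (L - 2 if j = L - 1, since then t ≥ L).
short-shift-exit-below-top : ∀ {p L j t} .{{_ : NonZero p}} → 3 ≤ L → 0 < j → j < L → 0 < t →
                             L + t < p → ∃ λ i → i < L × IsExit p L j t i
short-shift-exit-below-top {p} {L} {j} {t} _ 0<j j<L 0<t L+t<p with t ≤? j
... | yes t≤j = j ∸ t , ≤-<-trans (m∸n≤m j t) j<L ,
                hole-exit (≤-trans (m∸n≤m j t) (<⇒≤ j<L) , <⇒≢ (∸-monoʳ-< 0<t t≤j))
                          (trans (cong (_% p) (m∸n+n≡m t≤j)) (m<n⇒m%n≡m j<p))
  where
  j<p : j < p
  j<p = <-trans j<L (≤-<-trans (m≤m+n L t) L+t<p)
short-shift-exit-below-top {p} {suc L₁} {j} {t} (s≤s _) 0<j j<L 0<t L+t<p | no t≰j with j ≟ L₁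
... | no j≢L₁ = L₁ , n<1+n L₁ ,
                gap-exit (n≤1+n L₁ , ≢-sym j≢L₁) (k+m≤m+n L₁ 2≤t) (≤-<-trans (n≤1+n _) L+t<p)
  where
  2≤t : 2 ≤ t
  2≤t = ≤-trans (s≤s 0<j) (≰⇒> t≰j)
short-shift-exit-below-top {p} {suc (suc (suc m))} {t = t} (s≤s (s≤s (s≤s _))) _ _ _ L+t<p
  | no t≰j | yes refl =
  suc m , s≤s (n≤1+n _) ,
  gap-exit (i≤L , <⇒≢ (n<1+n _)) (s≤s (k+m≤m+n m 3≤t)) (≤-<-trans (+-monoˡ-≤ t i≤L) L+t<p)
  where
  i≤L : suc m ≤ suc (suc (suc m))
  i≤L = ≤-trans (n≤1+n _) (n≤1+n _)
  3≤t : 3 ≤ t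
  3≤t = ≤-trans (s≤s (s≤s (s≤s z≤n))) (≰⇒> t≰j)

short-shift : ∀ {p L j t} .{{_ : NonZero p}} → 3 ≤ L → 0 < j → j < L → 0 < t → L + t < p →
              TwoExits p L j t
short-shift {L = L} 3≤L 0<j j<L 0<t L+t<p =
  let i , i<L , i-exit = short-shift-exit-below-top 3≤L 0<j j<L 0<t L+t<p in
  L , i , >⇒≢ i<L , gap-exit (≤-refl , >⇒≢ j<L) (m<m+n L 0<t) L+t<p , i-exit

-- Either p + j - t lands on the hole after wrapping around, or L + t < p + j and 1 lands in the gap
-- (2 if j = 1).
long-shift-exit-above-bottom : ∀ {p L j t} .{{_ : NonZero p}} → 3 ≤ L → 0 < j → j < L → L < t →
                               t < p → ∃ λ i → 0 < i × IsExit p L j t i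
long-shift-exit-above-bottom {p} {L} {j} {t} 3≤L 0<j j<L L<t t<p with p + j ≤? L + t
... | yes p+j≤L+t = i , m<n⇒0<n∸m t<p+j ,
                    hole-exit (+-cancelʳ-≤ t i L (subst (_≤ L + t) (sym i+t≡p+j) p+j≤L+t) , i≢j)
                              (trans (cong (_% p) i+t≡p+j) (trans (%-remove-+ˡ j (∣-refl {p})) j%p≡j))
  where
  t<p+j : t < p + j
  t<p+j = <-≤-trans t<p (m≤m+n p j)
  i : ℕ
  i = p + j ∸ t
  i+t≡p+j : i + t ≡ p + j
  i+t≡p+j = m∸n+n≡m (<⇒≤ t<p+j)
  i≢j : i ≢ j
  i≢j i≡j = <⇒≢ t<p (+-cancelˡ-≡ j t p (trans (cong (_+ t) (sym i≡j)) (trans i+t≡p+j (+-comm p j))))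
  j%p≡j : j % p ≡ j
  j%p≡j = m<n⇒m%n≡m (<-trans j<L (<-trans L<t t<p))
... | no p+j≰L+t with j ≟ 1
...   | no j≢1 = 1 , s≤s z≤n , gap-exit (≤-trans (s≤s z≤n) 3≤L , ≢-sym j≢1) (m<n⇒m<1+n L<t) 2+t≤p
  where
  open ≤-Reasoning
  2+t≤p : 2 + t ≤ p
  2+t≤p = +-cancelˡ-≤ j (2 + t) p (begin
    j + (2 + t)  ≡⟨ x∙yz≈y∙xz j 2 t ⟩
    2 + j + t    ≤⟨ +-monoˡ-≤ t (s≤s j<L) ⟩
    suc L + t    ≤⟨ ≰⇒> p+j≰L+t ⟩
    p + j        ≡⟨ +-comm p j ⟩
    j + p        ∎)
...   | yes refl = 2 , s≤s z≤n ,
                   gap-exit (≤-trans (s≤s (s≤s z≤n)) 3≤L , λ ()) (m<n⇒m<1+n (m<n⇒m<1+n L<t)) 3+t≤p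
  where
  open ≤-Reasoning
  3+t≤p : 3 + t ≤ p
  3+t≤p = s≤s⁻¹ (begin
    4 + t      ≤⟨ +-monoˡ-≤ t (s≤s 3≤L) ⟩
    suc L + t  ≤⟨ ≰⇒> p+j≰L+t ⟩
    p + 1      ≡⟨ +-comm p 1 ⟩
    suc p      ∎)

long-shift : ∀ {p L j t} .{{_ : NonZero p}} → 3 ≤ L → 0 < j → j < L → L < t → t < p → TwoExits p L j t
long-shift 3≤L 0<j j<L L<t t<p =
  let i , 0<i , i-exit = long-shift-exit-above-bottom 3≤L 0<j j<L L<t t<p in
  0 , i , <⇒≢ 0<i , gap-exit (z≤n , <⇒≢ 0<j) L<t t<p , i-exit

wrapping-shift : ∀ {p L j t} .{{_ : NonZero p}} → t ≤ L → p ≤ L + t → L + 4 ≤ p → TwoExits p L j t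
wrapping-shift {p} {L} {j} {t} t≤L p≤L+t L+4≤p =
  two-of-three c j λ k k≤2 c+k≢j → gap-exit (c+k≤L k≤2 , c+k≢j) (L<c+k+t k) (c+k+t<p k≤2)
  where
  open ≤-Reasoning
  c : ℕ
  c = suc L ∸ t
  c+k+t≡L+1+k : ∀ k → c + k + t ≡ L + suc k
  c+k+t≡L+1+k k = begin-equality
    c + k + t    ≡⟨ xy∙z≈xz∙y c k t ⟩
    c + t + k    ≡⟨ cong (_+ k) (m∸n+n≡m (m≤n⇒m≤1+n t≤L)) ⟩
    suc L + k    ≡⟨ +-suc L k ⟨
    L + suc k    ∎
  L<c+k+t : ∀ k → L < c + k + t
  L<c+k+t k = begin-strict
    L            <⟨ m<m+n L (s≤s z≤n) ⟩
    L + suc k    ≡⟨ c+k+t≡L+1+k k ⟨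
    c + k + t    ∎
  c+k+t<p : ∀ {k} → k ≤ 2 → c + k + t < p
  c+k+t<p {k} k≤2 = begin-strict
    c + k + t    ≡⟨ c+k+t≡L+1+k k ⟩
    L + suc k    <⟨ +-monoʳ-< L (s≤s (s≤s k≤2)) ⟩
    L + 4        ≤⟨ L+4≤p ⟩
    p            ∎
  c+k≤L : ∀ {k} → k ≤ 2 → c + k ≤ L
  c+k≤L {k} k≤2 = +-cancelʳ-≤ t (c + k) L (begin
    c + k + t    ≡⟨ c+k+t≡L+1+k k ⟩
    L + suc k    ≤⟨ +-monoʳ-≤ L (≤-trans (s≤s k≤2) 3≤t) ⟩
    L + t        ∎)
    where
    3≤t : 3 ≤ t
    3≤t = ≤-trans (n≤1+n 3) (+-cancelˡ-≤ L 4 t (≤-trans L+4≤p p≤L+t))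

two-exits : ∀ {p L j t} .{{_ : NonZero p}} → 3 ≤ L → L + 4 ≤ p → 0 < j → j < L → 0 < t → t < p →
            TwoExits p L j t
two-exits {p} {L} {t = t} 3≤L L+4≤p 0<j j<L 0<t t<p with L <? t | L + t <? p
... | yes L<t | _         = long-shift 3≤L 0<j j<L L<t t<p
... | no L≮t  | yes L+t<p = short-shift 3≤L 0<j j<L 0<t L+t<p
... | no L≮t  | no L+t≮p  = wrapping-shift (≮⇒≥ L≮t) (≮⇒≥ L+t≮p) L+4≤p

module _ {p : ℕ} .{{_ : NonZero p}} {X : Subset p} {y d : Fin p}
         (X≡AP : ∀ z → z ∈ X ⇔ Σ ℕ λ k → k < ∣ X ∣ × z ≡ y +ₚ (k ·ₚ d)) where

  ap-last : ∀ {z} → z ∈ X → (z +ₚ d) ∉ X → z ≡ y +ₚ (pred ∣ X ∣ ·ₚ d)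
  ap-last {z} z∈X z+d∉X with Equivalence.to (X≡AP z) z∈X
  ... | k , k<∣X∣ , z≡y+kd = trans z≡y+kd (cong (λ k → y +ₚ (k ·ₚ d)) (cong pred 1+k≡∣X∣))
    where
    z+d≡y+[1+k]d : z +ₚ d ≡ y +ₚ (suc k ·ₚ d)
    z+d≡y+[1+k]d = trans (cong (_+ₚ d) z≡y+kd) (sym (·ₚ-suc y d k))
    1+k≡∣X∣ : suc k ≡ ∣ X ∣
    1+k≡∣X∣ = ≤-antisym k<∣X∣ (≮⇒≥ λ 1+k<∣X∣ →
      z+d∉X (Equivalence.from (X≡AP _) (suc k , 1+k<∣X∣ , z+d≡y+[1+k]d)))

module _ {p : ℕ} .{{_ : NonZero p}} where
  open ≡-Reasoning

  ∈-interval⇔ : ∀ a b {z} → z ∈ interval a b ⇔ offset a z ≤ offset a b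
  ∈-interval⇔ a b = ∈-tabulate⇔ (λ z → offset a z ≤? offset a b)

  ∈-interval⇒< : ∀ a b {z} → z ∈ interval a b → z ≢ b → offset a z < offset a b
  ∈-interval⇒< a b z∈I z≢b = ≤∧≢⇒< (Equivalence.to (∈-interval⇔ a b) z∈I) (z≢b ∘ offset-injective a)

  ∣interval∣ : ∀ a b → ∣ interval a b ∣ ≡ suc (offset a b)
  ∣interval∣ a b = trans (∣tabulate∣-permute (λ w → does (toℕ w ≤? offset a b)) (translation a))
                         (∣tabulate-≤∣ (offset a b) (toℕ<n (b -ₚ a)))

  ⊕-∈-interval⇔ : ∀ a b i → a ⊕ i ∈ interval a b ⇔ i % p ≤ offset a b
  ⊕-∈-interval⇔ a b i =
    subst (λ r → a ⊕ i ∈ interval a b ⇔ r ≤ offset a b) (offset-⊕ a i) (∈-interval⇔ a b)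

  ⊕≡⇔ : ∀ a i z → a ⊕ i ≡ z ⇔ i % p ≡ offset a z
  ⊕≡⇔ a i z = mk⇔ (λ eq → trans (sym (offset-⊕ a i)) (cong (offset a) eq))
                  (λ eq → offset-injective a (trans (offset-⊕ a i) eq))

  ⊕-∈-punctured⇔ : ∀ a b x i →
                   a ⊕ i ∈ interval a b ∩ ∁ ⁅ x ⁆ ⇔ Punctured (offset a b) (offset a x) (i % p)
  ⊕-∈-punctured⇔ a b x i = mk⇔
    (λ ∈X → let ∈I , ∈∁x = x∈p∩q⁻ _ _ ∈X in
            Equivalence.to (⊕-∈-interval⇔ a b i) ∈I ,
            x∈∁p⇒x∉p ∈∁x ∘ Equivalence.from x∈⁅y⁆⇔x≡y ∘ Equivalence.from (⊕≡⇔ a i x))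
    (λ (≤L , ≢j) → x∈p∩q⁺ (Equivalence.from (⊕-∈-interval⇔ a b i) ≤L ,
                            x∉p⇒x∈∁p (≢j ∘ Equivalence.to (⊕≡⇔ a i x) ∘ Equivalence.to x∈⁅y⁆⇔x≡y)))

  ⊕-injective : ∀ a {i k} → i < p → k < p → a ⊕ i ≡ a ⊕ k → i ≡ k
  ⊕-injective a {i} {k} i<p k<p eq = begin
    i                ≡⟨ m<n⇒m%n≡m i<p ⟨
    i % p            ≡⟨ offset-⊕ a i ⟨
    offset a (a ⊕ i) ≡⟨ cong (offset a) eq ⟩
    offset a (a ⊕ k) ≡⟨ offset-⊕ a k ⟩
    k % p            ≡⟨ m<n⇒m%n≡m k<p ⟩
    k                ∎

  ⊕-exit : ∀ a b x d {i} → IsExit p (offset a b) (offset a x) (toℕ d) i →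
           a ⊕ i ∈ interval a b ∩ ∁ ⁅ x ⁆ × (a ⊕ i) +ₚ d ∉ interval a b ∩ ∁ ⁅ x ⁆
  ⊕-exit a b x d {i} (i∈@(i≤L , _) , i+t∉) =
    Equivalence.from (⊕-∈-punctured⇔ a b x i) (subst (Punctured _ _) (sym (m<n⇒m%n≡m i<p)) i∈) ,
    λ i+d∈ → i+t∉ (Equivalence.to (⊕-∈-punctured⇔ a b x (i + toℕ d)) (subst (_∈ _) (⊕-+ a i _) i+d∈))
    where
    i<p : i < p
    i<p = ≤-<-trans i≤L (toℕ<n (b -ₚ a))

lemma2p5 : (p : ℕ) → .{{_ : NonZero p}} → Prime p → (a b : Fin p) →
    4 ≤ ∣ interval a b ∣ → ∣ interval a b ∣ ≤ p ∸ 3 →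
    (x : Fin p) → x ∈ interval a b → x ≢ a → x ≢ b →
    ¬ IsAP (interval a b ∩ ∁ ⁅ x ⁆)
lemma2p5 p _ a b 4≤∣I∣ ∣I∣≤p∸3 x x∈I x≢a x≢b (y , d , d≢0 , X≡AP) =
  let i₁ , i₂ , i₁≢i₂ , exit₁ , exit₂ =
        two-exits 3≤L L+4≤p (offset-positive a x≢a) (∈-interval⇒< a b x∈I x≢b) (toℕ-positive d≢0) (toℕ<n d)
      z₁∈X , z₁+d∉X = ⊕-exit a b x d exit₁
      z₂∈X , z₂+d∉X = ⊕-exit a b x d exit₂
  in i₁≢i₂ (⊕-injective a (exit<p exit₁) (exit<p exit₂)
                         (trans (ap-last X≡AP z₁∈X z₁+d∉X) (sym (ap-last X≡AP z₂∈X z₂+d∉X))))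
  where
  L : ℕ
  L = offset a b
  L<p : L < p
  L<p = toℕ<n (b -ₚ a)
  3≤L : 3 ≤ L
  3≤L = s≤s⁻¹ (subst (4 ≤_) (∣interval∣ a b) 4≤∣I∣)
  L+4≤p : L + 4 ≤ p
  L+4≤p = subst (_≤ p) (sym (+-suc L 3))
            (m≤o∸n⇒m+n≤o (suc L) (≤-trans 3≤L (<⇒≤ L<p)) (subst (_≤ p ∸ 3) (∣interval∣ a b) ∣I∣≤p∸3))
  exit<p : ∀ {j t i} → IsExit p L j t i → i < p
  exit<p ((i≤L , _) , _) = ≤-<-trans i≤L L<p
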